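{- Let $n\ge 2$ and $j\in[[n]]$, and let $H=BP_n\setminus V(BP_n^j)$ be the graph obtained from the burnt pancake graph $BP_n$ by deleting all vertices of the cluster $BP_n^j$. Then the (vertex) connectivity of $H$ is $\kappa(H)=n-1$.
   Context: Let $[n]=\{1,\dots,n\}$, $\bar i=-i$, $[[n]]=[n]\cup\{\bar i: i\in[n]\}$. A signed permutation of $[n]$ is a sequence $x=x_1\cdots x_n$ of elements of $[[n]]$ with $|x_1|\cdots|x_n|$ a permutation of $[n]$. For $1\le i\le n$, $x^i=\bar x_i\bar x_{i-1}\cdots\bar x_1x_{i+1}\cdots x_n$. The burnt pancake graph $BP_n$ has vertex set all signed permutations of $[n]$, with $x\sim y$ iff $y=x^i$ for some $1\le i\le n$. For $j\in[[n]]$, the cluster $BP_n^j$ is the subgraph of $BP_n$ induced by the vertices whose last entry $x_n$ equals $j$. $\kappa(G)$ denotes the minimum size of a vertex set whose removal disconnects $G$ or leaves a trivial graph. -}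

module Defs where

open import Data.Nat using (ℕ; suc; _≤_; _∸_)
open import Data.Integer using (ℤ; ∣_∣; -_)
open import Data.List using (List; []; _∷_; map; upTo; take; drop; reverse; _++_; last; length)
open import Data.Maybe using (just)
open import Data.Product using (Σ; _×_; ∃; ∃-syntax)
open import Data.Sum using (_⊎_)
open import Data.List.Membership.Propositional using (_∉_)
open import Data.List.Relation.Unary.All using (All)
open import Data.List.Relation.Unary.Unique.Propositional using (Unique)
open import Data.List.Relation.Binary.Permutation.Propositional using (_↭_)
open import Relation.Binary.PropositionalEquality using (_≡_)
open import Relation.Nullary using (¬_)

-- Generic graphs: a vertex predicate V on a carrier A and an adjacency
-- relation E.  The graph is the one induced on {x | V x}.

-- Paths whose vertices all satisfy W (the start u is assumed in W).
data Reach {A : Set} (W : A → Set) (E : A → A → Set) : A → A → Set where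
  here : ∀ {u} → Reach W E u u
  step : ∀ {u v w} → E u v → W v → Reach W E v w → Reach W E u w

Remain : {A : Set} → (A → Set) → List A → A → Set
Remain V S x = V x × x ∉ S

Separates : {A : Set} → (A → Set) → (A → A → Set) → List A → Set
Separates V E S =
  (∃[ u ] ∃[ v ] (Remain V S u × Remain V S v × ¬ Reach (Remain V S) E u v))
  ⊎ (∀ u v → Remain V S u → Remain V S v → u ≡ v)

IsCut : {A : Set} → (A → Set) → (A → A → Set) → List A → Set
IsCut V E S = Unique S × All V S × Separates V E S

Connectivity : {A : Set} → (A → Set) → (A → A → Set) → ℕ → Set
Connectivity V E k =
  (∃[ S ] (IsCut V E S × length S ≡ k)) × (∀ S → IsCut V E S → k ≤ length S)

SignedPerm : ℕ → List ℤ → Set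
SignedPerm n x = map ∣_∣ x ↭ map suc (upTo n)

flip : ℕ → List ℤ → List ℤ
flip i x = reverse (map -_ (take i x)) ++ drop i x

BPAdj : ℕ → List ℤ → List ℤ → Set
BPAdj n x y = ∃[ i ] (1 ≤ i × i ≤ n × y ≡ flip i x)

InSignedRange : ℕ → ℤ → Set
InSignedRange n j = 1 ≤ ∣ j ∣ × ∣ j ∣ ≤ n

-- vertices of H = BP_n minus the cluster BP_n^j (last entry x_n ≠ j)
HVertex : ℕ → ℤ → List ℤ → Set
HVertex n j x = SignedPerm n x × ¬ (last x ≡ just j)

-- Generalise over the label set: for m + 1 labels, deleting a set F of clusters (the vertices
-- whose last entry lies in F) and a set S of vertices with |F| + |S| ≤ m leaves BP connected.
-- Induction on m: a cluster is a copy of BP on the other labels, so two vertices of one cluster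
-- are connected as soon as at most m - 1 deleted vertices lie in it.  Call a cluster intact if
-- it is neither deleted nor contains a deleted vertex.  Every vertex reaches an intact cluster:
-- directly, by its full flip, or through a bridge vertex (-c, …, k) of its own cluster k, whose
-- full flip lies in cluster c; the 2m + 2 choices of c outnumber the damage.  Intact clusters
-- c, c′ with |c| ≠ |c′| are joined through one bridge vertex, opposite ones through a third
-- intact cluster.
--
-- With F = {j} this gives κ(H) ≥ n - 1; that H - S is not a single vertex when |S| ≤ n - 2
-- follows by counting the 2n - 2 bridge vertices of cluster -j.  Conversely the full flip of
-- (-j, …, k) lies in the deleted cluster j, so its n - 1 other neighbours separate it.

module Submission where

open import Defs
open import Data.Nat using (ℕ; zero; suc; _≤_; _<_; _∸_; _+_; _⊓_; z≤n; s≤s)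
open import Data.Nat.Properties as ℕ using (≤-refl)
open import Data.Integer as ℤ using (ℤ; ∣_∣; -_; +_; -[1+_])
open import Data.Integer.Properties using (neg-involutive; neg-injective; ∣-i∣≡∣i∣; +-injective)
open import Data.List using (List; []; _∷_; [_]; _∷ʳ_; map; upTo; take; drop; reverse; _++_; last; length; filter; deduplicate)
open import Data.List.Properties using (length-map; length-++; length-++-comm; length-reverse; length-take; length-upTo; length-filter; length-deduplicate; map-++; map-∘; map-cong; map-id; reverse-map; reverse-involutive; unfold-reverse; take-all; drop-all; take++drop≡id; ++-assoc; ++-identityʳ; ∷-injective; ≡-dec; filter-none; filter-notAll)
open import Data.List.Membership.Propositional using (_∈_; _∉_; find)
open import Data.List.Membership.Propositional.Properties using (∈-map⁺; ∈-map⁻; ∈-∃++; ∈-++⁻; ∈-++⁺ˡ; ∈-++⁺ʳ; ∈-filter⁺; ∈-filter⁻; ∈-upTo⁺; ∈-upTo⁻; ∈-deduplicate⁺; ∈-deduplicate⁻; ∈-length)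
open import Data.List.Relation.Binary.Subset.Propositional using (_⊆_)
open import Data.List.Relation.Binary.Permutation.Propositional using (_↭_; ↭-refl; ↭-sym; ↭-trans; ↭-reflexive; prep; swap; ↭⇒↭ₛ; module PermutationReasoning)
open import Data.List.Relation.Binary.Permutation.Propositional.Properties using (∈-resp-↭; ↭-length; shift; ++⁺ʳ; ↭-reverse; ∷↭∷ʳ; drop-∷; ↭-singleton-inv)
import Data.List.Relation.Binary.Permutation.Setoid.Properties as ↭ₛ
open import Data.List.Relation.Unary.All as All using (all?)
open import Data.List.Relation.Unary.All.Properties using (¬All⇒Any¬)
open import Data.List.Relation.Unary.Any as Any using (here; there)
open import Data.List.Relation.Unary.AllPairs as AllPairs using (_∷_)
open import Data.List.Relation.Unary.Unique.Propositional using (Unique)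
import Data.List.Relation.Unary.Unique.Propositional.Properties as Unique
open import Data.List.Relation.Unary.Unique.DecPropositional.Properties (≡-dec ℤ._≟_) using (deduplicate-!)
open import Data.List.Membership.DecPropositional ℤ._≟_ using () renaming (_∈?_ to _∈ℤ?_)
open import Data.Maybe using (Maybe; just)
open import Data.Maybe.Properties using (just-injective)
open import Data.Empty using (⊥)
open import Data.Product using (∃-syntax; _×_; _,_; proj₁; proj₂)
open import Data.Sum using (_⊎_; inj₁; inj₂)
open import Function using (_∘_; case_of_)
open import Relation.Binary.Definitions using (DecidableEquality)
open import Relation.Binary.PropositionalEquality using (_≡_; _≢_; refl; sym; trans; cong; cong₂; subst; subst₂; setoid; module ≡-Reasoning)
open import Relation.Nullary using (¬?; yes; no; contradiction)

module _ {A : Set} {W : A → Set} {E : A → A → Set} where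

  Reach-trans : ∀ {u v w} → Reach W E u v → Reach W E v w → Reach W E u w
  Reach-trans here q = q
  Reach-trans (step e wv p) q = step e wv (Reach-trans p q)

  Reach-sym : (∀ {u v} → W u → E u v → E v u) → ∀ {u v} → W u → Reach W E u v → Reach W E v u
  Reach-sym sym-E wu here = here
  Reach-sym sym-E wu (step e wv p) = Reach-trans (Reach-sym sym-E wv p) (step (sym-E wu e) wu here)

Reach-map : {A B : Set} {W : A → Set} {E : A → A → Set} {W′ : B → Set} {E′ : B → B → Set}
  (f : A → B) → (∀ {x} → W x → W′ (f x)) → (∀ {x y} → W x → E x y → E′ (f x) (f y)) →
  ∀ {u v} → W u → Reach W E u v → Reach W′ E′ (f u) (f v)
Reach-map f W⇒ E⇒ wu here = here
Reach-map f W⇒ E⇒ wu (step e wv p) = step (E⇒ wu e) (W⇒ wv) (Reach-map f W⇒ E⇒ wv p)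

Reach-mono : {A : Set} {W W′ : A → Set} {E : A → A → Set} → (∀ {x} → W x → W′ x) →
  ∀ {u v} → Reach W E u v → Reach W′ E u v
Reach-mono W⇒ here = here
Reach-mono W⇒ (step e wv p) = step e (W⇒ wv) (Reach-mono W⇒ p)

Unique-resp-↭ : {A : Set} {xs ys : List A} → xs ↭ ys → Unique xs → Unique ys
Unique-resp-↭ p = ↭ₛ.Unique-resp-↭ (setoid _) (↭⇒↭ₛ p)

∈-↭-∷ : {A : Set} {x y : A} {xs ys : List A} → xs ↭ y ∷ ys → x ∈ xs → x ≢ y → x ∈ ys
∈-↭-∷ p x∈xs x≢y with ∈-resp-↭ p x∈xs
... | here x≡y = contradiction x≡y x≢y
... | there x∈ys = x∈ys

∈⇒↭∷ : {A : Set} {x : A} {xs : List A} → x ∈ xs → ∃[ ys ] (xs ↭ x ∷ ys)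
∈⇒↭∷ {x = x} x∈xs with ∈-∃++ x∈xs
... | ys , zs , refl = ys ++ zs , shift x ys zs

Unique-⊆⇒length≤ : {A : Set} {xs ys : List A} → Unique xs → xs ⊆ ys → length xs ≤ length ys
Unique-⊆⇒length≤ {xs = []} _ _ = z≤n
Unique-⊆⇒length≤ {xs = x ∷ xs} {ys} (x∉xs ∷ u) sub with ∈⇒↭∷ (sub (here refl))
... | ys′ , ys↭ = ℕ.≤-trans (s≤s (Unique-⊆⇒length≤ u sub′)) (ℕ.≤-reflexive (sym (↭-length ys↭)))
  where
  sub′ : xs ⊆ ys′
  sub′ z∈xs = ∈-↭-∷ ys↭ (sub (there z∈xs)) (λ z≡x → All.lookup x∉xs z∈xs (sym z≡x))

module _ {A B : Set} (_≟_ : DecidableEquality B) where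
  open import Data.List.Membership.DecPropositional _≟_ using (_∈?_)

  pigeonhole : {f : A → B} → (∀ {x y} → f x ≡ f y → x ≡ y) →
    {xs : List A} {ys : List B} → Unique xs → length ys < length xs → ∃[ x ] (x ∈ xs × f x ∉ ys)
  pigeonhole {f} f-inj {xs} {ys} u |ys|<|xs| with all? (λ x → f x ∈? ys) xs
  ... | no ¬all = find (¬All⇒Any¬ (λ x → f x ∈? ys) xs ¬all)
  ... | yes all∈ = contradiction (ℕ.<-≤-trans |ys|<|xs| |xs|≤|ys|) (ℕ.<-irrefl refl)
    where
    fxs⊆ys : map f xs ⊆ ys
    fxs⊆ys y∈ with ∈-map⁻ f y∈
    ... | x , x∈xs , refl = All.lookup all∈ x∈xs
    |xs|≤|ys| : length xs ≤ length ys
    |xs|≤|ys| = subst (_≤ length ys) (length-map f xs) (Unique-⊆⇒length≤ (Unique.map⁺ f-inj u) fxs⊆ys)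

_≟L_ : DecidableEquality (List ℤ)
_≟L_ = ≡-dec ℤ._≟_

delete : ℕ → List ℕ → List ℕ
delete e [] = []
delete e (x ∷ xs) with x ℕ.≟ e
... | yes _ = xs
... | no _ = x ∷ delete e xs

↭-delete : ∀ {e xs} → e ∈ xs → xs ↭ e ∷ delete e xs
↭-delete {e} {x ∷ xs} e∈ with x ℕ.≟ e
... | yes refl = ↭-refl
↭-delete {e} {x ∷ xs} (here refl) | no x≢e = contradiction refl x≢e
↭-delete {e} {x ∷ xs} (there e∈) | no _ = ↭-trans (prep x (↭-delete e∈)) (swap x e ↭-refl)

-- Signed labels and prefix reversals

∣i∣≡∣j∣⇒j≡i⊎j≡-i : ∀ i j → ∣ i ∣ ≡ ∣ j ∣ → j ≡ i ⊎ j ≡ - i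
∣i∣≡∣j∣⇒j≡i⊎j≡-i (+ m) (+ .m) refl = inj₁ refl
∣i∣≡∣j∣⇒j≡i⊎j≡-i (+ .(suc n)) -[1+ n ] refl = inj₂ refl
∣i∣≡∣j∣⇒j≡i⊎j≡-i -[1+ m ] (+ .(suc m)) refl = inj₂ refl
∣i∣≡∣j∣⇒j≡i⊎j≡-i -[1+ m ] -[1+ .m ] refl = inj₁ refl

-i≡i⇒i≡0 : ∀ i → - i ≡ i → i ≡ + 0
-i≡i⇒i≡0 (+ zero) _ = refl

signed : List ℕ → List ℤ
signed L = map +_ L ++ map (-_ ∘ +_) L

length-signed : ∀ L → length (signed L) ≡ length L + length L
length-signed L = trans (length-++ (map +_ L)) (cong₂ _+_ (length-map +_ L) (length-map (-_ ∘ +_) L))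

∈-signed⁻ : ∀ {b L} → b ∈ signed L → ∣ b ∣ ∈ L
∈-signed⁻ {b} {L} b∈ with ∈-++⁻ (map +_ L) b∈
... | inj₁ b∈+ with ∈-map⁻ +_ b∈+
...   | a , a∈L , refl = a∈L
∈-signed⁻ {b} {L} b∈ | inj₂ b∈- with ∈-map⁻ (-_ ∘ +_) b∈-
...   | a , a∈L , refl = subst (_∈ L) (sym (∣-i∣≡∣i∣ (+ a))) a∈L

Unique-signed : ∀ {L} → Unique L → 0 ∉ L → Unique (signed L)
Unique-signed {L} u 0∉L = Unique.++⁺ (Unique.map⁺ +-injective u) (Unique.map⁺ (+-injective ∘ neg-injective) u) disjoint
  where
  disjoint : ∀ {b} → b ∈ map +_ L × b ∈ map (-_ ∘ +_) L → ⊥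
  disjoint (b∈+ , b∈-) with ∈-map⁻ +_ b∈+ | ∈-map⁻ (-_ ∘ +_) b∈-
  ... | a , a∈L , refl | zero , 0∈L , _ = 0∉L 0∈L

-- The junk value 0 on [] is never a signed label.
last₀ : List ℤ → ℤ
last₀ [] = + 0
last₀ (a ∷ []) = a
last₀ (_ ∷ b ∷ t) = last₀ (b ∷ t)

init : List ℤ → List ℤ
init [] = []
init (a ∷ []) = []
init (a ∷ b ∷ t) = a ∷ init (b ∷ t)

last₀-∷ʳ : ∀ y k → last₀ (y ∷ʳ k) ≡ k
last₀-∷ʳ [] k = refl
last₀-∷ʳ (a ∷ []) k = refl
last₀-∷ʳ (a ∷ b ∷ y) k = last₀-∷ʳ (b ∷ y) k

init-∷ʳ : ∀ y k → init (y ∷ʳ k) ≡ y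
init-∷ʳ [] k = refl
init-∷ʳ (a ∷ []) k = refl
init-∷ʳ (a ∷ b ∷ y) k = cong (a ∷_) (init-∷ʳ (b ∷ y) k)

last-∷ʳ : ∀ y (k : ℤ) → last (y ∷ʳ k) ≡ just k
last-∷ʳ [] k = refl
last-∷ʳ (a ∷ []) k = refl
last-∷ʳ (a ∷ b ∷ y) k = last-∷ʳ (b ∷ y) k

init-∷ʳ-last₀ : ∀ {x} → x ≢ [] → x ≡ init x ∷ʳ last₀ x
init-∷ʳ-last₀ {[]} x≢[] = contradiction refl x≢[]
init-∷ʳ-last₀ {a ∷ []} _ = refl
init-∷ʳ-last₀ {a ∷ b ∷ t} _ = cong (a ∷_) (init-∷ʳ-last₀ {b ∷ t} λ ())

last≡just-last₀ : ∀ {x} → x ≢ [] → last x ≡ just (last₀ x)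
last≡just-last₀ {x} x≢[] = trans (cong last (init-∷ʳ-last₀ x≢[])) (last-∷ʳ (init x) (last₀ x))

last₀∈tail : ∀ a b t → last₀ (a ∷ b ∷ t) ∈ b ∷ t
last₀∈tail a b [] = here refl
last₀∈tail a b (c ∷ t) = there (last₀∈tail b c t)

take-++ˡ : ∀ {A : Set} i (y z : List A) → i ≤ length y → take i (y ++ z) ≡ take i y
take-++ˡ zero y z _ = refl
take-++ˡ (suc i) (a ∷ y) z (s≤s i≤) = cong (a ∷_) (take-++ˡ i y z i≤)

drop-++ˡ : ∀ {A : Set} i (y z : List A) → i ≤ length y → drop i (y ++ z) ≡ drop i y ++ z
drop-++ˡ zero y z _ = refl
drop-++ˡ (suc i) (a ∷ y) z (s≤s i≤) = drop-++ˡ i y z i≤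

flip-∷ʳ : ∀ i y k → i ≤ length y → flip i (y ∷ʳ k) ≡ flip i y ∷ʳ k
flip-∷ʳ i y k i≤ = begin
  reverse (map -_ (take i (y ++ [ k ]))) ++ drop i (y ++ [ k ])
    ≡⟨ cong₂ (λ p s → reverse (map -_ p) ++ s) (take-++ˡ i y [ k ] i≤) (drop-++ˡ i y [ k ] i≤) ⟩
  reverse (map -_ (take i y)) ++ drop i y ++ [ k ]
    ≡⟨ ++-assoc (reverse (map -_ (take i y))) (drop i y) [ k ] ⟨
  flip i y ∷ʳ k ∎
  where open ≡-Reasoning

flip-involutive : ∀ i x → i ≤ length x → flip i (flip i x) ≡ x
flip-involutive i x i≤ = begin
  reverse (map -_ (take i (r ++ d))) ++ drop i (r ++ d)
    ≡⟨ cong₂ (λ p s → reverse (map -_ p) ++ s) (trans (take-++ˡ i r d i≤|r|) (take-all i r |r|≤i))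
                                             (trans (drop-++ˡ i r d i≤|r|) (cong (_++ d) (drop-all i r |r|≤i))) ⟩
  reverse (map -_ r) ++ d
    ≡⟨ cong (_++ d) reverse-map-neg-r ⟩
  take i x ++ d
    ≡⟨ take++drop≡id i x ⟩
  x ∎
  where
  open ≡-Reasoning
  r = reverse (map -_ (take i x))
  d = drop i x
  |r|≡i : length r ≡ i
  |r|≡i = begin
    length (reverse (map -_ (take i x))) ≡⟨ length-reverse (map -_ (take i x)) ⟩
    length (map -_ (take i x))           ≡⟨ length-map -_ (take i x) ⟩
    length (take i x)                    ≡⟨ length-take i x ⟩
    i ⊓ length x                         ≡⟨ ℕ.m≤n⇒m⊓n≡m i≤ ⟩
    i                                    ∎
  i≤|r| : i ≤ length r
  i≤|r| = ℕ.≤-reflexive (sym |r|≡i)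
  |r|≤i : length r ≤ i
  |r|≤i = ℕ.≤-reflexive |r|≡i
  reverse-map-neg-r : reverse (map -_ r) ≡ take i x
  reverse-map-neg-r = begin
    reverse (map -_ (reverse (map -_ (take i x))))
      ≡⟨ cong reverse (reverse-map -_ (map -_ (take i x))) ⟩
    reverse (reverse (map -_ (map -_ (take i x))))
      ≡⟨ reverse-involutive _ ⟩
    map -_ (map -_ (take i x))
      ≡⟨ map-∘ (take i x) ⟨
    map (-_ ∘ -_) (take i x)
      ≡⟨ map-cong neg-involutive (take i x) ⟩
    map (λ z → z) (take i x)
      ≡⟨ map-id (take i x) ⟩
    take i x ∎

abs-flip : ∀ i x → map ∣_∣ (flip i x) ↭ map ∣_∣ x
abs-flip i x = begin
  map ∣_∣ (reverse (map -_ t) ++ d)       ≡⟨ map-++ ∣_∣ (reverse (map -_ t)) d ⟩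
  map ∣_∣ (reverse (map -_ t)) ++ map ∣_∣ d ≡⟨ cong (_++ map ∣_∣ d) (reverse-map ∣_∣ (map -_ t)) ⟩
  reverse (map ∣_∣ (map -_ t)) ++ map ∣_∣ d ≡⟨ cong (λ s → reverse s ++ map ∣_∣ d) abs-neg ⟩
  reverse (map ∣_∣ t) ++ map ∣_∣ d         ↭⟨ ++⁺ʳ (map ∣_∣ d) (↭-reverse (map ∣_∣ t)) ⟩
  map ∣_∣ t ++ map ∣_∣ d                   ≡⟨ map-++ ∣_∣ t d ⟨
  map ∣_∣ (t ++ d)                         ≡⟨ cong (map ∣_∣) (take++drop≡id i x) ⟩
  map ∣_∣ x ∎
  where
  open PermutationReasoning
  t = take i x
  d = drop i x
  abs-neg : map ∣_∣ (map -_ t) ≡ map ∣_∣ t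
  abs-neg = trans (sym (map-∘ t)) (map-cong ∣-i∣≡∣i∣ t)

last₀-flip-length : ∀ a t → last₀ (flip (length (a ∷ t)) (a ∷ t)) ≡ - a
last₀-flip-length a t = begin
  last₀ (reverse (map -_ (take n x)) ++ drop n x)
    ≡⟨ cong₂ (λ p s → last₀ (reverse (map -_ p) ++ s)) (take-all n x ≤-refl) (drop-all n x ≤-refl) ⟩
  last₀ (reverse (map -_ x) ++ [])               ≡⟨ cong last₀ (++-identityʳ (reverse (map -_ x))) ⟩
  last₀ (reverse (map -_ x))                     ≡⟨ cong last₀ (unfold-reverse (- a) (map -_ t)) ⟩
  last₀ (reverse (map -_ t) ∷ʳ - a)              ≡⟨ last₀-∷ʳ (reverse (map -_ t)) (- a) ⟩
  - a ∎
  where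
  open ≡-Reasoning
  x = a ∷ t
  n = length x

last₀-flip-length≢last₀ : ∀ x → Unique (map ∣_∣ x) → 2 ≤ length x → last₀ (flip (length x) x) ≢ last₀ x
last₀-flip-length≢last₀ (a ∷ []) _ (s≤s ())
last₀-flip-length≢last₀ (a ∷ b ∷ t) (∣a∣∉ ∷ _) _ -a≡last =
  All.lookup ∣a∣∉ (∈-map⁺ ∣_∣ (last₀∈tail a b t)) (begin
    ∣ a ∣                                     ≡⟨ ∣-i∣≡∣i∣ a ⟨
    ∣ - a ∣                                   ≡⟨ cong ∣_∣ (sym (last₀-flip-length a (b ∷ t))) ⟩
    ∣ last₀ (flip (length (a ∷ b ∷ t)) (a ∷ b ∷ t)) ∣ ≡⟨ cong ∣_∣ -a≡last ⟩
    ∣ last₀ (a ∷ b ∷ t) ∣ ∎)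
  where open ≡-Reasoning

SignedPermOf : List ℕ → List ℤ → Set
SignedPermOf L x = map ∣_∣ x ↭ L

record LabelSet (m : ℕ) (L : List ℕ) : Set where
  field
    length≡ : length L ≡ m
    unique : Unique L
    0∉ : 0 ∉ L

LabelSet-∷ : ∀ {m L e L′} → LabelSet (suc m) L → L ↭ e ∷ L′ → LabelSet m L′
LabelSet-∷ lab L↭ = record
  { length≡ = ℕ.suc-injective (trans (sym (↭-length L↭)) length≡)
  ; unique = AllPairs.tail (Unique-resp-↭ L↭ unique)
  ; 0∉ = λ 0∈L′ → 0∉ (∈-resp-↭ (↭-sym L↭) (there 0∈L′))
  }
  where open LabelSet lab

length-SignedPermOf : ∀ {L x} → SignedPermOf L x → length x ≡ length L
length-SignedPermOf {L} {x} p = trans (sym (length-map ∣_∣ x)) (↭-length p)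

SignedPermOf-flip : ∀ {L x} i → SignedPermOf L x → SignedPermOf L (flip i x)
SignedPermOf-flip i p = ↭-trans (abs-flip i _) p

abs-∷ʳ : ∀ y k → map ∣_∣ (y ∷ʳ k) ↭ ∣ k ∣ ∷ map ∣_∣ y
abs-∷ʳ y k = ↭-trans (↭-reflexive (map-++ ∣_∣ y [ k ])) (↭-sym (∷↭∷ʳ ∣ k ∣ (map ∣_∣ y)))

SignedPermOf-∷ʳ : ∀ {L L′ y k} → L ↭ ∣ k ∣ ∷ L′ → SignedPermOf L′ y → SignedPermOf L (y ∷ʳ k)
SignedPermOf-∷ʳ {y = y} {k} L↭ p = ↭-trans (abs-∷ʳ y k) (↭-trans (prep ∣ k ∣ p) (↭-sym L↭))

SignedPermOf-∷ʳ⇒↭ : ∀ {L y k} → SignedPermOf L (y ∷ʳ k) → L ↭ ∣ k ∣ ∷ map ∣_∣ y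
SignedPermOf-∷ʳ⇒↭ {y = y} {k} p = ↭-trans (↭-sym p) (abs-∷ʳ y k)

-- A vertex of cluster k whose full flip lies in cluster c.
bridgeVertex : List ℕ → ℤ → ℤ → List ℤ
bridgeVertex L′ k c = ((- c) ∷ map +_ (delete ∣ c ∣ L′)) ∷ʳ k

bridgeVertex-injective : ∀ {L′ k c c′} → bridgeVertex L′ k c ≡ bridgeVertex L′ k c′ → c ≡ c′
bridgeVertex-injective eq = neg-injective (proj₁ (∷-injective eq))

SignedPermOf-bridgeVertex : ∀ {L L′ k c} → L ↭ ∣ k ∣ ∷ L′ → ∣ c ∣ ∈ L′ →
                            SignedPermOf L (bridgeVertex L′ k c)
SignedPermOf-bridgeVertex {L′ = L′} {c = c} L↭ c∈L′ =
  SignedPermOf-∷ʳ {y = (- c) ∷ map +_ (delete ∣ c ∣ L′)} L↭ (begin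
    ∣ - c ∣ ∷ map ∣_∣ (map +_ (delete ∣ c ∣ L′)) ≡⟨ cong₂ _∷_ (∣-i∣≡∣i∣ c) abs-pos ⟩
    ∣ c ∣ ∷ delete ∣ c ∣ L′                     ↭⟨ ↭-delete c∈L′ ⟨
    L′                                          ∎)
  where
  open PermutationReasoning
  abs-pos : map ∣_∣ (map +_ (delete ∣ c ∣ L′)) ≡ delete ∣ c ∣ L′
  abs-pos = trans (sym (map-∘ (delete ∣ c ∣ L′))) (map-id (delete ∣ c ∣ L′))

last₀-bridgeVertex : ∀ L′ k c → last₀ (bridgeVertex L′ k c) ≡ k
last₀-bridgeVertex L′ k c = last₀-∷ʳ ((- c) ∷ map +_ (delete ∣ c ∣ L′)) k

last-bridgeVertex : ∀ L′ k c → last (bridgeVertex L′ k c) ≡ just k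
last-bridgeVertex L′ k c = last-∷ʳ ((- c) ∷ map +_ (delete ∣ c ∣ L′)) k

last₀-flip-bridgeVertex : ∀ L′ k c → last₀ (flip (length (bridgeVertex L′ k c)) (bridgeVertex L′ k c)) ≡ c
last₀-flip-bridgeVertex L′ k c =
  trans (last₀-flip-length (- c) (map +_ (delete ∣ c ∣ L′) ∷ʳ k)) (neg-involutive c)

-- Connectivity after deleting clusters and vertices

Alive : List ℕ → List ℤ → List (List ℤ) → List ℤ → Set
Alive L F S x = SignedPermOf L x × last₀ x ∉ F × x ∉ S

clusterOf : ℤ → List (List ℤ) → List (List ℤ)
clusterOf k = filter (λ x → last₀ x ℤ.≟ k)

∷ʳ∈⇒∈-init-clusterOf : ∀ {y k S} → y ∷ʳ k ∈ S → y ∈ map init (clusterOf k S)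
∷ʳ∈⇒∈-init-clusterOf {y} {k} y∷ʳk∈S =
  subst (_∈ _) (init-∷ʳ y k) (∈-map⁺ init (∈-filter⁺ (λ x → last₀ x ℤ.≟ k) y∷ʳk∈S (last₀-∷ʳ y k)))

∈-init-clusterOf⇒∷ʳ∈ : ∀ {y k S} → k ≢ + 0 → y ∈ map init (clusterOf k S) → y ∷ʳ k ∈ S
∈-init-clusterOf⇒∷ʳ∈ {k = k} k≢0 y∈ with ∈-map⁻ init y∈
... | x , x∈ , refl with ∈-filter⁻ (λ x → last₀ x ℤ.≟ k) x∈
...   | x∈S , refl = subst (_∈ _) (init-∷ʳ-last₀ x≢[]) x∈S
  where
  x≢[] : x ≢ []
  x≢[] refl = k≢0 refl

BPAdj-sym : ∀ {n x y} → length x ≡ n → BPAdj n x y → BPAdj n y x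
BPAdj-sym refl (i , 1≤i , i≤n , refl) = i , 1≤i , i≤n , sym (flip-involutive i _ i≤n)

RobustlyConnected : ℕ → Set
RobustlyConnected m = ∀ {L} → LabelSet (suc m) L → ∀ F S → length F + length S ≤ m →
  ∀ {u v} → Alive L F S u → Alive L F S v → Reach (Alive L F S) (BPAdj (suc m)) u v

map-abs-singleton : ∀ {v a} → map ∣_∣ v ≡ [ a ] → ∃[ s ] (v ≡ [ s ] × ∣ s ∣ ≡ a)
map-abs-singleton {s ∷ []} refl = s , refl , refl

robustlyConnected-0 : RobustlyConnected 0
robustlyConnected-0 lab _ _ _ {s ∷ []} {v} au av with map-abs-singleton (↭-singleton-inv (↭-trans (proj₁ av) (↭-sym (proj₁ au))))
... | s′ , refl , ∣s′∣≡∣s∣ with ∣i∣≡∣j∣⇒j≡i⊎j≡-i s s′ (sym ∣s′∣≡∣s∣)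
...   | inj₁ refl = here
...   | inj₂ refl = step (1 , ≤-refl , ≤-refl , refl) av here
robustlyConnected-0 lab _ _ _ {[]} au av with trans (length-SignedPermOf {x = []} (proj₁ au)) (LabelSet.length≡ lab)
... | ()
robustlyConnected-0 lab _ _ _ {u@(_ ∷ _ ∷ _)} au av with trans (length-SignedPermOf {x = u} (proj₁ au)) (LabelSet.length≡ lab)
... | ()

module RobustlyConnected-suc {m} (IH : RobustlyConnected m) {L} (lab : LabelSet (suc (suc m)) L)
                             (F : List ℤ) (S : List (List ℤ)) (budget : length F + length S ≤ suc m) where

  open LabelSet lab

  n : ℕ
  n = suc (suc m)

  A : List ℤ → Set
  A = Alive L F S

  E : List ℤ → List ℤ → Set
  E = BPAdj n

  damaged : List ℤ
  damaged = F ++ map last₀ S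

  others : List ℤ → List ℕ
  others x = map ∣_∣ (init x)

  length-damaged : length damaged ≤ suc m
  length-damaged = subst (_≤ suc m) (sym (trans (length-++ F) (cong (λ l → length F + l) (length-map last₀ S)))) budget

  length-alive : ∀ {x} → A x → length x ≡ n
  length-alive {x} ax = trans (length-SignedPermOf {x = x} (proj₁ ax)) length≡

  split : ∀ {x} → A x → x ≡ init x ∷ʳ last₀ x
  split ax = init-∷ʳ-last₀ λ { refl → ℕ.0≢1+n (length-alive ax) }

  labels-split : ∀ {x} → A x → L ↭ ∣ last₀ x ∣ ∷ others x
  labels-split {x} ax = SignedPermOf-∷ʳ⇒↭ {y = init x} (subst (SignedPermOf L) (split ax) (proj₁ ax))

  labels-others : ∀ {x} → A x → LabelSet (suc m) (others x)
  labels-others ax = LabelSet-∷ lab (labels-split ax)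

  others-∌-last : ∀ {x a} → A x → a ∈ others x → a ≢ ∣ last₀ x ∣
  others-∌-last ax a∈ a≡∣k∣ = All.lookup (AllPairs.head (Unique-resp-↭ (labels-split ax) unique)) a∈ (sym a≡∣k∣)

  last₀≢0 : ∀ {x} → A x → last₀ x ≢ + 0
  last₀≢0 ax k≡0 = 0∉ (∈-resp-↭ (↭-sym (labels-split ax)) (here (sym (cong ∣_∣ k≡0))))

  alive-intact : ∀ {x} → SignedPermOf L x → last₀ x ∉ damaged → A x
  alive-intact px k∉ = px , (λ k∈F → k∉ (∈-++⁺ˡ k∈F)) , (λ x∈S → k∉ (∈-++⁺ʳ F (∈-map⁺ last₀ x∈S)))

  clusterOf-intact : ∀ {k} → k ∉ damaged → length (clusterOf k S) ≤ m
  clusterOf-intact {k} k∉ =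
    subst (λ c → length c ≤ m) (sym (filter-none (λ x → last₀ x ℤ.≟ k) (All.tabulate last≢k))) z≤n
    where
    last≢k : ∀ {x} → x ∈ S → last₀ x ≢ k
    last≢k x∈S refl = k∉ (∈-++⁺ʳ F (∈-map⁺ last₀ x∈S))

  -- The removal budget cannot be spent entirely inside cluster k once another cluster is damaged too.
  clusterOf-small : ∀ {k k′} → k′ ∈ damaged → k′ ≢ k → length (clusterOf k S) ≤ m
  clusterOf-small {k} k′∈ k′≢k with ∈-++⁻ F k′∈
  ... | inj₁ k′∈F = ℕ.≤-pred (ℕ.≤-trans (s≤s (length-filter (λ x → last₀ x ℤ.≟ k) S))
                              (ℕ.≤-trans (ℕ.+-monoˡ-≤ (length S) (∈-length k′∈F)) budget))
  ... | inj₂ k′∈ with ∈-map⁻ last₀ k′∈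
  ...   | x , x∈S , refl =
    ℕ.≤-pred (ℕ.≤-trans (filter-notAll (λ x → last₀ x ℤ.≟ k) S (Any.map (λ { refl → k′≢k }) x∈S))
                        (ℕ.≤-trans (ℕ.m≤n+m (length S) (length F)) budget))

  fullFlip : ∀ {x} → A x → last₀ (flip n x) ∉ damaged → A (flip n x) × E x (flip n x)
  fullFlip ax k∉ = alive-intact (SignedPermOf-flip n (proj₁ ax)) k∉ , n , s≤s z≤n , ≤-refl , refl

  -- Cluster k is a copy of BP on the other labels, with the deleted vertices of cluster k and no
  -- deleted clusters.
  withinCluster : ∀ {p q} → A p → A q → last₀ p ≡ last₀ q → length (clusterOf (last₀ p) S) ≤ m → Reach A E p q
  withinCluster {p} {q} ap aq same small =
    subst₂ (Reach A E) (sym (split ap)) (sym (trans (split aq) (cong (init q ∷ʳ_) (sym same))))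
      (Reach-map (_∷ʳ k) lift lift-edge (descend ap refl)
        (IH (labels-others ap) [] S′ small′ (descend ap refl) (descend aq (sym same))))
    where
    k = last₀ p
    L′ = others p
    L↭ : L ↭ ∣ k ∣ ∷ L′
    L↭ = labels-split ap
    S′ = map init (clusterOf k S)
    small′ : length {A = ℤ} [] + length S′ ≤ m
    small′ = subst (_≤ m) (sym (length-map init (clusterOf k S))) small
    descend : ∀ {x} → A x → last₀ x ≡ k → Alive L′ [] S′ (init x)
    descend {x} ax lx = drop-∷ (↭-trans (↭-sym L↭x) L↭) , (λ ()) ,
                        λ y∈ → proj₂ (proj₂ ax) (subst (_∈ S) (sym x≡) (∈-init-clusterOf⇒∷ʳ∈ (last₀≢0 ap) y∈))
      where
      L↭x : L ↭ ∣ k ∣ ∷ others x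
      L↭x = subst (λ c → L ↭ ∣ c ∣ ∷ others x) lx (labels-split ax)
      x≡ : x ≡ init x ∷ʳ k
      x≡ = trans (split ax) (cong (init x ∷ʳ_) lx)
    lift : ∀ {w} → Alive L′ [] S′ w → A (w ∷ʳ k)
    lift {w} (pw , _ , w∉S′) = SignedPermOf-∷ʳ L↭ pw , subst (_∉ F) (sym (last₀-∷ʳ w k)) (proj₁ (proj₂ ap)) ,
                               λ w∷ʳk∈S → w∉S′ (∷ʳ∈⇒∈-init-clusterOf w∷ʳk∈S)
    lift-edge : ∀ {w w′} → Alive L′ [] S′ w → BPAdj (suc m) w w′ → E (w ∷ʳ k) (w′ ∷ʳ k)
    lift-edge {w} (pw , _) (i , 1≤i , i≤ , refl) =
      i , 1≤i , ℕ.m≤n⇒m≤1+n i≤ , sym (flip-∷ʳ i w k (subst (i ≤_) (sym |w|≡) i≤))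
      where
      |w|≡ : length w ≡ suc m
      |w|≡ = trans (length-SignedPermOf {x = w} pw) (LabelSet.length≡ (labels-others ap))

  cross : ∀ {x c} → A x → length (clusterOf (last₀ x) S) ≤ m → ∣ c ∣ ∈ others x → c ∉ damaged →
          bridgeVertex (others x) (last₀ x) c ∉ S → ∃[ z ] (A z × last₀ z ≡ c × Reach A E x z)
  cross {x} {c} ax small c∈ c∉ w∉S =
    let aw′ , w→w′ = fullFlip aw (subst (_∉ damaged) (sym last≡c) c∉)
    in flip n w , aw′ , last≡c ,
       Reach-trans (withinCluster ax aw (sym (last₀-bridgeVertex (others x) k c)) small) (step w→w′ aw′ here)
    where
    k = last₀ x
    w = bridgeVertex (others x) k c
    pw : SignedPermOf L w
    pw = SignedPermOf-bridgeVertex {k = k} {c = c} (labels-split ax) c∈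
    aw : A w
    aw = pw , subst (_∉ F) (sym (last₀-bridgeVertex (others x) k c)) (proj₁ (proj₂ ax)) , w∉S
    last≡c : last₀ (flip n w) ≡ c
    last≡c = subst (λ i → last₀ (flip i w) ≡ c) (trans (length-SignedPermOf {x = w} pw) length≡)
                   (last₀-flip-bridgeVertex (others x) k c)

  crossIntact : ∀ {x c} → A x → last₀ x ∉ damaged → ∣ c ∣ ∈ others x → c ∉ damaged →
                ∃[ z ] (A z × last₀ z ≡ c × Reach A E x z)
  crossIntact {x} {c} ax k∉ c∈ c∉ = cross ax (clusterOf-intact k∉) c∈ c∉ λ w∈S →
    k∉ (∈-++⁺ʳ F (subst (_∈ map last₀ S) (last₀-bridgeVertex (others x) (last₀ x) c) (∈-map⁺ last₀ w∈S)))

  -- The damaged clusters and the deleted vertices of cluster k are too few to block every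
  -- bridge vertex of cluster k.
  escapeDamaged : ∀ {u} → A u → last₀ (flip n u) ∈ damaged → ∃[ x ] (A x × last₀ x ∉ damaged × Reach A E u x)
  escapeDamaged {u} au flip∈ =
    escapeVia (pigeonhole _≟L_ (bridgeVertex-injective {others u} {k}) (Unique-signed unique′ 0∉′) |blocked|<)
    where
    open LabelSet (labels-others au) renaming (length≡ to length≡′; unique to unique′; 0∉ to 0∉′)
    k = last₀ u
    bridge = bridgeVertex (others u) k
    blocked = map bridge damaged ++ clusterOf k S
    small : length (clusterOf k S) ≤ m
    small = clusterOf-small flip∈ (subst (λ i → last₀ (flip i u) ≢ k) (length-alive au)
                                         (last₀-flip-length≢last₀ u (Unique-resp-↭ (↭-sym (proj₁ au)) unique)
                                                                    (subst (2 ≤_) (sym (length-alive au)) (s≤s (s≤s z≤n)))))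
    |blocked|< : length blocked < length (signed (others u))
    |blocked|< = begin-strict
      length blocked                                      ≡⟨ length-++ (map bridge damaged) ⟩
      length (map bridge damaged) + length (clusterOf k S) ≡⟨ cong (_+ length (clusterOf k S)) (length-map bridge damaged) ⟩
      length damaged + length (clusterOf k S)              ≤⟨ ℕ.+-mono-≤ length-damaged small ⟩
      suc m + m                                            <⟨ ℕ.+-monoʳ-< (suc m) (ℕ.n<1+n m) ⟩
      suc m + suc m                                        ≡⟨ cong₂ _+_ length≡′ length≡′ ⟨
      length (others u) + length (others u)                ≡⟨ length-signed (others u) ⟨
      length (signed (others u))                           ∎
      where open ℕ.≤-Reasoning
    escapeVia : ∃[ c ] (c ∈ signed (others u) × bridge c ∉ blocked) → ∃[ x ] (A x × last₀ x ∉ damaged × Reach A E u x)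
    escapeVia (c , c∈ , w∉) =
      let c∉ : c ∉ damaged
          c∉ c∈D = w∉ (∈-++⁺ˡ (∈-map⁺ bridge c∈D))
          w∉S : bridge c ∉ S
          w∉S w∈ = w∉ (∈-++⁺ʳ _ (∈-filter⁺ (λ x → last₀ x ℤ.≟ k) w∈ (last₀-bridgeVertex (others u) k c)))
          z , az , z∈c , r = cross au small (∈-signed⁻ c∈) c∉ w∉S
      in z , az , subst (_∉ damaged) (sym z∈c) c∉ , r

  escape : ∀ {u} → A u → ∃[ x ] (A x × last₀ x ∉ damaged × Reach A E u x)
  escape {u} au with last₀ u ∈ℤ? damaged
  ... | no k∉ = u , au , k∉ , here
  ... | yes _ with last₀ (flip n u) ∈ℤ? damaged
  ...   | yes flip∈ = escapeDamaged au flip∈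
  ...   | no flip∉ = let av , e = fullFlip au flip∉ in flip n u , av , flip∉ , step e av here

  linkAcross : ∀ {x y} → A x → A y → last₀ x ∉ damaged → last₀ y ∉ damaged → ∣ last₀ x ∣ ≢ ∣ last₀ y ∣ →
               Reach A E x y
  linkAcross {x} {y} ax ay kx∉ ky∉ ∣kx∣≢∣ky∣ =
    let z , az , z∈ky , r = crossIntact ax kx∉ ∣ky∣∈others ky∉
    in Reach-trans r (withinCluster az ay z∈ky (clusterOf-intact (subst (_∉ damaged) (sym z∈ky) ky∉)))
    where
    ∣ky∣∈others : ∣ last₀ y ∣ ∈ others x
    ∣ky∣∈others = ∈-↭-∷ (labels-split ax) (∈-resp-↭ (↭-sym (labels-split ay)) (here refl)) (∣kx∣≢∣ky∣ ∘ sym)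

  -- Opposite clusters k and -k are joined through a third intact cluster d:
  -- at most m + 1 of the 2m + 2 signed labels d with |d| ≠ |k| are damaged.
  linkOpposite : ∀ {x y} → A x → A y → last₀ x ∉ damaged → last₀ y ∉ damaged → ∣ last₀ x ∣ ≡ ∣ last₀ y ∣ →
                 Reach A E x y
  linkOpposite {x} {y} ax ay kx∉ ky∉ ∣kx∣≡∣ky∣ =
    viaIntact (pigeonhole ℤ._≟_ (λ e → e) (Unique-signed unique′ 0∉′) |damaged|<)
    where
    open LabelSet (labels-others ax) renaming (length≡ to length≡′; unique to unique′; 0∉ to 0∉′)
    |damaged|< : length damaged < length (signed (others x))
    |damaged|< = begin-strict
      length damaged                        ≤⟨ length-damaged ⟩
      suc m                                 <⟨ ℕ.m<n+m (suc m) (s≤s z≤n) ⟩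
      suc m + suc m                         ≡⟨ cong₂ _+_ length≡′ length≡′ ⟨
      length (others x) + length (others x) ≡⟨ length-signed (others x) ⟨
      length (signed (others x))            ∎
      where open ℕ.≤-Reasoning
    viaIntact : ∃[ d ] (d ∈ signed (others x) × d ∉ damaged) → Reach A E x y
    viaIntact (d , d∈ , d∉) =
      let z , az , z∈d , r = crossIntact ax kx∉ (∈-signed⁻ d∈) d∉
          ∣d∣≢∣ky∣ : ∣ last₀ z ∣ ≢ ∣ last₀ y ∣
          ∣d∣≢∣ky∣ e = others-∌-last ax (∈-signed⁻ d∈) (trans (cong ∣_∣ (sym z∈d)) (trans e (sym ∣kx∣≡∣ky∣)))
      in Reach-trans r (linkAcross az ay (subst (_∉ damaged) (sym z∈d) d∉) ky∉ ∣d∣≢∣ky∣)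

  linkIntact : ∀ {x y} → A x → A y → last₀ x ∉ damaged → last₀ y ∉ damaged → Reach A E x y
  linkIntact {x} {y} ax ay kx∉ ky∉ with last₀ x ℤ.≟ last₀ y
  ... | yes kx≡ky = withinCluster ax ay kx≡ky (clusterOf-intact kx∉)
  ... | no _ with ∣ last₀ x ∣ ℕ.≟ ∣ last₀ y ∣
  ...   | yes ∣kx∣≡∣ky∣ = linkOpposite ax ay kx∉ ky∉ ∣kx∣≡∣ky∣
  ...   | no ∣kx∣≢∣ky∣ = linkAcross ax ay kx∉ ky∉ ∣kx∣≢∣ky∣

  connected : ∀ {u v} → A u → A v → Reach A E u v
  connected au av =
    let x , ax , kx∉ , u⇝x = escape au
        y , ay , ky∉ , v⇝y = escape av
    in Reach-trans u⇝x (Reach-trans (linkIntact ax ay kx∉ ky∉) (Reach-sym (λ aw → BPAdj-sym (length-alive aw)) av v⇝y))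

robustlyConnected : ∀ m → RobustlyConnected m
robustlyConnected zero = robustlyConnected-0
robustlyConnected (suc m) lab F S budget = RobustlyConnected-suc.connected (robustlyConnected m) lab F S budget

-- The burnt pancake graph without the cluster of j

labelsUpTo : ∀ n → LabelSet n (map suc (upTo n))
labelsUpTo n = record
  { length≡ = trans (length-map suc (upTo n)) (length-upTo n)
  ; unique = Unique.map⁺ ℕ.suc-injective (Unique.upTo⁺ n)
  ; 0∉ = λ 0∈ → case ∈-map⁻ suc 0∈ of λ ()
  }

module ClusterDeleted (n′ : ℕ) (j : ℤ) (j∈ : InSignedRange (suc (suc n′)) j) where

  n : ℕ
  n = suc (suc n′)

  L : List ℕ
  L = map suc (upTo n)

  H : List ℤ → Set
  H = HVertex n j

  E : List ℤ → List ℤ → Set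
  E = BPAdj n

  nonempty : ∀ {x} → SignedPerm n x → x ≢ []
  nonempty px refl = ℕ.0≢1+n (trans (length-SignedPermOf {x = []} px) (LabelSet.length≡ (labelsUpTo n)))

  remain⇒alive : ∀ {S x} → Remain H S x → Alive L [ j ] S x
  remain⇒alive ((px , last≢j) , x∉S) =
    px , (λ { (here k≡j) → last≢j (trans (last≡just-last₀ (nonempty px)) (cong just k≡j)) }) , x∉S

  alive⇒remain : ∀ {S x} → Alive L [ j ] S x → Remain H S x
  alive⇒remain (px , k∉ , x∉S) =
    (px , λ last≡j → k∉ (here (just-injective (trans (sym (last≡just-last₀ (nonempty px))) last≡j)))) , x∉S

  outside-j : ∀ {l : Maybe ℤ} {k} → l ≡ just k → k ≢ j → l ≢ just j
  outside-j l≡k k≢j l≡j = k≢j (just-injective (trans (sym l≡k) l≡j))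

  j≢0 : j ≢ + 0
  j≢0 refl with proj₁ j∈
  ... | ()

  -j≢j : - j ≢ j
  -j≢j -j≡j = j≢0 (-i≡i⇒i≡0 j -j≡j)

  ∣j∣∈L : ∣ j ∣ ∈ L
  ∣j∣∈L with ∣ j ∣ | proj₁ j∈ | proj₂ j∈
  ... | suc i | _ | ∣j∣≤n = ∈-map⁺ suc (∈-upTo⁺ ∣j∣≤n)

  connectedAfter : ∀ {S u v} → length S ≤ n′ → Remain H S u → Remain H S v → Reach (Remain H S) E u v
  connectedAfter {S} |S|≤ ru rv =
    Reach-mono alive⇒remain (robustlyConnected (suc n′) (labelsUpTo n) [ j ] S (s≤s |S|≤) (remain⇒alive ru) (remain⇒alive rv))

  Lj : List ℕ
  Lj = delete ∣ j ∣ L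

  L↭-j : L ↭ ∣ - j ∣ ∷ Lj
  L↭-j = subst (λ a → L ↭ a ∷ Lj) (sym (∣-i∣≡∣i∣ j)) (↭-delete ∣j∣∈L)

  labels-Lj : LabelSet (suc n′) Lj
  labels-Lj = LabelSet-∷ (labelsUpTo n) L↭-j

  remain-bridge : ∀ {S c} → c ∈ signed Lj → bridgeVertex Lj (- j) c ∉ S → Remain H S (bridgeVertex Lj (- j) c)
  remain-bridge {c = c} c∈ w∉S =
    (SignedPermOf-bridgeVertex {k = - j} {c = c} L↭-j (∈-signed⁻ c∈) , outside-j (last-bridgeVertex Lj (- j) c) -j≢j) , w∉S

  -- The cluster of -j has 2n - 2 bridge vertices, more than n - 1 ≥ |S| + 1.
  twoSurvivors : ∀ {S} → length S ≤ n′ → ∃[ u ] ∃[ v ] (Remain H S u × Remain H S v × u ≢ v)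
  twoSurvivors {S} |S|≤ =
    let b₁ , b₁∈ , w₁∉S = pick (ℕ.m≤n⇒m≤1+n |S|≤)
        b₂ , b₂∈ , w₂∉ = pick {w b₁ ∷ S} (s≤s |S|≤)
    in w b₂ , w b₁ , remain-bridge b₂∈ (w₂∉ ∘ there) , remain-bridge b₁∈ w₁∉S , w₂∉ ∘ here
    where
    w = bridgeVertex Lj (- j)
    open LabelSet labels-Lj
    pick : ∀ {ys} → length ys ≤ suc n′ → ∃[ c ] (c ∈ signed Lj × w c ∉ ys)
    pick {ys} |ys|≤ = pigeonhole _≟L_ (bridgeVertex-injective {Lj} { - j}) (Unique-signed unique 0∉) (begin-strict
      length ys             ≤⟨ |ys|≤ ⟩
      suc n′                <⟨ ℕ.m<n+m (suc n′) (s≤s z≤n) ⟩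
      suc n′ + suc n′       ≡⟨ cong₂ _+_ length≡ length≡ ⟨
      length Lj + length Lj ≡⟨ length-signed Lj ⟨
      length (signed Lj)    ∎)
      where open ℕ.≤-Reasoning

  lowerBound : ∀ S → IsCut H E S → n ∸ 1 ≤ length S
  lowerBound S (_ , _ , separates) with suc n′ ℕ.≤? length S
  ... | yes n-1≤ = n-1≤
  ... | no n-1≰ with separates | ℕ.≤-pred (ℕ.≰⇒> n-1≰)
  ...   | inj₁ (u , v , ru , rv , ¬u⇝v) | |S|≤ = contradiction (connectedAfter |S|≤ ru rv) ¬u⇝v
  ...   | inj₂ trivial | |S|≤ = let u , v , ru , rv , u≢v = twoSurvivors |S|≤ in contradiction (trivial u v ru rv) u≢v

  kb-∈ : ∃[ a ] (a ∈ Lj)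
  kb-∈ = nonempty-∈ {xs = Lj} (LabelSet.length≡ labels-Lj)
    where
    nonempty-∈ : ∀ {xs : List ℕ} {m} → length xs ≡ suc m → ∃[ a ] (a ∈ xs)
    nonempty-∈ {a ∷ _} _ = a , here refl

  kb : ℕ
  kb = proj₁ kb-∈

  ∣j∣≢kb : ∣ j ∣ ≢ kb
  ∣j∣≢kb = All.lookup (AllPairs.head (Unique-resp-↭ (↭-delete ∣j∣∈L) (LabelSet.unique (labelsUpTo n)))) (proj₂ kb-∈)

  ∣k∣≡kb⇒k≢j : ∀ {k} → ∣ k ∣ ≡ kb → k ≢ j
  ∣k∣≡kb⇒k≢j ∣k∣≡kb refl = ∣j∣≢kb ∣k∣≡kb

  kb∈L : kb ∈ L
  kb∈L = ∈-resp-↭ (↭-sym (↭-delete ∣j∣∈L)) (there (proj₂ kb-∈))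

  Lk : List ℕ
  Lk = delete kb L

  L↭kb : L ↭ ∣ + kb ∣ ∷ Lk
  L↭kb = ↭-delete kb∈L

  L↭-kb : L ↭ ∣ - + kb ∣ ∷ Lk
  L↭-kb = subst (λ a → L ↭ a ∷ Lk) (sym (∣-i∣≡∣i∣ (+ kb))) L↭kb

  ∣j∣∈Lk : ∣ j ∣ ∈ Lk
  ∣j∣∈Lk = ∈-↭-∷ L↭kb ∣j∣∈L ∣j∣≢kb

  -- x₀ lies in cluster kb and its full flip lands in the deleted cluster j, so x₀ has only
  -- n - 1 neighbours in H.
  x₀ : List ℤ
  x₀ = bridgeVertex Lk (+ kb) j

  px₀ : SignedPerm n x₀
  px₀ = SignedPermOf-bridgeVertex {k = + kb} {c = j} L↭kb ∣j∣∈Lk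

  |x₀|≡n : length x₀ ≡ n
  |x₀|≡n = trans (length-SignedPermOf {x = x₀} px₀) (LabelSet.length≡ (labelsUpTo n))

  last-flip-x₀ : ∀ i → i ≤ suc n′ → last (flip i x₀) ≡ just (+ kb)
  last-flip-x₀ i i≤ = trans (cong last (flip-∷ʳ i y (+ kb) (subst (i ≤_) (sym |y|≡) i≤))) (last-∷ʳ (flip i y) (+ kb))
    where
    y = (- j) ∷ map +_ (delete ∣ j ∣ Lk)
    |y|≡ : length y ≡ suc n′
    |y|≡ = ℕ.suc-injective (trans (sym (length-++-comm y [ + kb ])) |x₀|≡n)

  last-flip-n-x₀ : last (flip n x₀) ≡ just j
  last-flip-n-x₀ = trans (last≡just-last₀ (nonempty (SignedPermOf-flip n px₀)))
    (cong just (subst (λ i → last₀ (flip i x₀) ≡ j) |x₀|≡n (last₀-flip-bridgeVertex Lk (+ kb) j)))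

  flips : List (List ℤ)
  flips = map (λ i → flip (suc i) x₀) (upTo (suc n′))

  -- Removing x₀ itself spares proving that no proper prefix flip fixes x₀; the lower bound then
  -- forces exactly n - 1 neighbours.
  neighbours : List (List ℤ)
  neighbours = filter (λ s → ¬? (s ≟L x₀)) (deduplicate _≟L_ flips)

  ∈-neighbours⁻ : ∀ {s} → s ∈ neighbours → ∃[ i ] (i < suc n′ × s ≡ flip (suc i) x₀)
  ∈-neighbours⁻ s∈ with ∈-filter⁻ (λ s → ¬? (s ≟L x₀)) {xs = deduplicate _≟L_ flips} s∈
  ... | s∈dedup , _ with ∈-map⁻ (λ i → flip (suc i) x₀) (∈-deduplicate⁻ _≟L_ flips s∈dedup)
  ...   | i , i∈ , s≡ = i , ∈-upTo⁻ i∈ , s≡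

  ∈-neighbours⁺ : ∀ {i} → 1 ≤ i → i < n → flip i x₀ ≢ x₀ → flip i x₀ ∈ neighbours
  ∈-neighbours⁺ {suc i} _ i<n ≢x₀ = ∈-filter⁺ (λ s → ¬? (s ≟L x₀))
    (∈-deduplicate⁺ _≟L_ (∈-map⁺ (λ i → flip (suc i) x₀) (∈-upTo⁺ (ℕ.≤-pred i<n)))) ≢x₀

  length-neighbours : length neighbours ≤ n ∸ 1
  length-neighbours = begin
    length neighbours                ≤⟨ length-filter (λ s → ¬? (s ≟L x₀)) (deduplicate _≟L_ flips) ⟩
    length (deduplicate _≟L_ flips)  ≤⟨ length-deduplicate _≟L_ flips ⟩
    length flips                     ≡⟨ length-map (λ i → flip (suc i) x₀) (upTo (suc n′)) ⟩
    length (upTo (suc n′))           ≡⟨ length-upTo (suc n′) ⟩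
    suc n′                           ∎
    where open ℕ.≤-Reasoning

  H-neighbours : ∀ {s} → s ∈ neighbours → H s
  H-neighbours s∈ with ∈-neighbours⁻ s∈
  ... | i , i< , refl = SignedPermOf-flip (suc i) px₀ , outside-j (last-flip-x₀ (suc i) i<) (∣k∣≡kb⇒k≢j refl)

  isolated : ∀ {w′ w} → w′ ≡ x₀ → Reach (Remain H neighbours) E w′ w → w ≡ x₀
  isolated w′≡x₀ here = w′≡x₀
  isolated refl (step (i , 1≤i , i≤n , refl) rw r) with ℕ.m≤n⇒m<n∨m≡n i≤n
  ... | inj₂ refl = contradiction last-flip-n-x₀ (proj₂ (proj₁ rw))
  ... | inj₁ i<n with flip i x₀ ≟L x₀
  ...   | yes flip≡x₀ = isolated flip≡x₀ r
  ...   | no flip≢x₀ = contradiction (∈-neighbours⁺ 1≤i i<n flip≢x₀) (proj₂ rw)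

  x₀∉neighbours : x₀ ∉ neighbours
  x₀∉neighbours x₀∈ = proj₂ (∈-filter⁻ (λ s → ¬? (s ≟L x₀)) {xs = deduplicate _≟L_ flips} x₀∈) refl

  Hx₀ : H x₀
  Hx₀ = px₀ , outside-j (last-bridgeVertex Lk (+ kb) j) (∣k∣≡kb⇒k≢j refl)

  v₀ : List ℤ
  v₀ = bridgeVertex Lk (- + kb) j

  Hv₀ : H v₀
  Hv₀ = SignedPermOf-bridgeVertex {k = - + kb} {c = j} L↭-kb ∣j∣∈Lk ,
        outside-j (last-bridgeVertex Lk (- + kb) j) (∣k∣≡kb⇒k≢j (∣-i∣≡∣i∣ (+ kb)))

  kb≢0 : kb ≢ 0
  kb≢0 kb≡0 = LabelSet.0∉ (labelsUpTo n) (subst (_∈ L) kb≡0 kb∈L)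

  v₀≢flip-x₀ : ∀ i → i ≤ suc n′ → v₀ ≢ flip i x₀
  v₀≢flip-x₀ i i≤ v₀≡ = kb≢0 (+-injective (-i≡i⇒i≡0 (+ kb) (just-injective (begin
    just (- + kb)      ≡⟨ last-bridgeVertex Lk (- + kb) j ⟨
    last v₀            ≡⟨ cong last v₀≡ ⟩
    last (flip i x₀)   ≡⟨ last-flip-x₀ i i≤ ⟩
    just (+ kb)        ∎))))
    where open ≡-Reasoning

  v₀∉neighbours : v₀ ∉ neighbours
  v₀∉neighbours v₀∈ = let i , i< , v₀≡ = ∈-neighbours⁻ v₀∈ in v₀≢flip-x₀ (suc i) i< v₀≡

  v₀≢x₀ : v₀ ≢ x₀
  v₀≢x₀ = v₀≢flip-x₀ 0 z≤n

  cut : IsCut H E neighbours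
  cut = Unique.filter⁺ (λ s → ¬? (s ≟L x₀)) (deduplicate-! flips) , All.tabulate H-neighbours ,
        inj₁ (x₀ , v₀ , (Hx₀ , x₀∉neighbours) , (Hv₀ , v₀∉neighbours) , v₀≢x₀ ∘ isolated refl)

  upperBound : ∃[ S ] (IsCut H E S × length S ≡ n ∸ 1)
  upperBound = neighbours , cut , ℕ.≤-antisym length-neighbours (lowerBound neighbours cut)

lemma7 : (n : ℕ) → 2 ≤ n → (j : ℤ) → InSignedRange n j →
    Connectivity (HVertex n j) (BPAdj n) (n ∸ 1)
lemma7 (suc (suc n′)) (s≤s (s≤s _)) j j∈ = upperBound , lowerBound
  where open ClusterDeleted n′ j j∈
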